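{- Let $\mathfrak{F}=\langle W,R\rangle$ be an $\mathbf{S4}$ frame (i.e. $R$ is reflexive and transitive). Then $\mathfrak{F}$ validates the formula \[\boldsymbol{su} = ((\neg p\to q)\land(\neg q\to p) \rightarrow r \vee s) \to ( p \rightarrow r) \vee(q \rightarrow s)\] if and only if $\mathfrak{F}$ satisfies $(su_2)$.
   Context: Formulas are built from propositional variables $p,q,r,s,\dots$ and $\bot$ with $\land,\lor,\to$; $\neg\alpha$ abbreviates $\alpha\to\bot$. $\mathfrak{F}$ validates a formula if it is true at every point of $\mathfrak{F}$ under every upward-closed (monotonic) valuation, using the standard intuitionistic Kripke semantics. For $X\subseteq W$ put $\mathord{\uparrow}X=\{w\in W:\exists x\in X,\ xRw\}$, $\Diamond X=\{w\in W:\exists x\in X,\ wRx\}$, $\Box X=\{w\in W:\forall v\,(wRv\Rightarrow v\in X)\}$. For $n\ge1$ and $z,x_0,\dots,x_{n-1}\in W$, say $z$ strongly unites $x_0,\dots,x_{n-1}$ if for every $i<n$: $zRx_i$ and $z\in\Box\big(\mathord{\uparrow}\{x_i\}\cup\bigcup_{i'\in n\setminus\{i\}}\Diamond\mathord{\uparrow}\{x_{i'}\}\big)$. The frame satisfies $(su_n)$ if for every $w\in W$ and all $x_0,\dots,x_{n-1}$ with $wRx_i$ for all $i$, there is $z$ with $wRz$ such that $z$ strongly unites $x_0,\dots,x_{n-1}$. -}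

module Defs where

open import Data.Nat using (ℕ)
open import Data.Fin using (Fin)
open import Data.Product using (Σ; ∃; _×_; _,_)
open import Data.Sum using (_⊎_)
open import Data.Empty renaming (⊥ to Empty)
open import Relation.Binary.PropositionalEquality using (_≡_; _≢_)

infixr 5 _⇒_
infixr 6 _∨_
infixr 7 _∧_
data Formula : Set where
  var : ℕ → Formula
  ⊥   : Formula
  _∧_ _∨_ _⇒_ : Formula → Formula → Formula

¬f_ : Formula → Formula
¬f a = a ⇒ ⊥

record Frame : Set₁ where
  field
    W : Set
    R : W → W → Set

record IsS4 (F : Frame) : Set where
  open Frame F
  field
    refl  : ∀ w → R w w
    trans : ∀ {u v w} → R u v → R v w → R u w

Valuation : Frame → Set₁
Valuation F = ℕ → Frame.W F → Set

Monotonic : (F : Frame) → Valuation F → Set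
Monotonic F V = ∀ n {w v} → Frame.R F w v → V n w → V n v

forces : (F : Frame) → Valuation F → Frame.W F → Formula → Set
forces F V w (var n) = V n w
forces F V w ⊥ = Empty
forces F V w (a ∧ b) = forces F V w a × forces F V w b
forces F V w (a ∨ b) = forces F V w a ⊎ forces F V w b
forces F V w (a ⇒ b) = ∀ v → Frame.R F w v → forces F V v a → forces F V v b

Validates : Frame → Formula → Set₁
Validates F φ = ∀ (V : Valuation F) → Monotonic F V → ∀ w → forces F V w φ

su : Formula
su = ((¬f p ⇒ q) ∧ (¬f q ⇒ p) ⇒ r ∨ s) ⇒ (p ⇒ r) ∨ (q ⇒ s)
  where
  p = var 0
  q = var 1
  r = var 2
  s = var 3

module _ (F : Frame) where
  open Frame F

  Subset : Set₁
  Subset = W → Set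

  ↑ : Subset → Subset
  ↑ X w = Σ W λ x → X x × R x w

  ◇ : Subset → Subset
  ◇ X w = Σ W λ x → X x × R w x

  □ : Subset → Subset
  □ X w = ∀ v → R w v → X v

  ｛_｝ : W → Subset
  ｛ x ｝ w = x ≡ w

  StronglyUnites : (n : ℕ) → W → (Fin n → W) → Set
  StronglyUnites n z x =
    ∀ (i : Fin n) → R z (x i) ×
      □ (λ v → ↑ ｛ x i ｝ v ⊎ (Σ (Fin n) λ i' → i' ≢ i × ◇ (↑ ｛ x i' ｝) v)) z

  SU : ℕ → Set
  SU n = ∀ (w : W) (x : Fin n → W) → (∀ i → R w (x i)) →
         Σ W λ z → R w z × StronglyUnites n z x

{-# OPTIONS --safe #-}

-- If (su₂) holds, take points x₀ ⊩ p, ⊮ r and x₁ ⊩ q, ⊮ s refuting p → r and q → s, and a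
-- point z strongly uniting them: every successor of z lies above x₁ (so forces q) or sees
-- above x₀ (so refutes ¬p), hence z forces ¬p → q, symmetrically ¬q → p, but neither r nor s.
-- Conversely, given w ≤ x₀, x₁, put p = ↑x₀, q = ↑x₁, r = "does not see x₀",
-- s = "does not see x₁". Then p → r and q → s fail at w, so su yields z ≥ w forcing
-- (¬p → q) ∧ (¬q → p) but not r ∨ s; the latter puts x₀ and x₁ above z, and the former
-- says precisely that z strongly unites x₀ and x₁.
module Submission where

open import Defs
open import Level using (0ℓ)
open import Axiom.ExcludedMiddle using (ExcludedMiddle)
open import Axiom.DoubleNegationElimination using (em⇒dne)
open import Function.Base using (_∘_)
open import Function.Bundles using (_⇔_; mk⇔; Equivalence)
open import Data.Nat using (suc)
open import Data.Fin using (Fin; zero; suc; opposite)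
open import Data.Vec.Functional using ([]; _∷_)
open import Data.Product using (Σ; ∃; _×_; _,_; proj₁)
open import Data.Sum using (_⊎_; inj₁; inj₂)
import Data.Sum as Sum
import Data.Product as Product
open import Data.Empty renaming (⊥ to Empty) using (⊥-elim)
open import Relation.Nullary using (¬_; yes; no)
open import Relation.Binary.PropositionalEquality using (refl; _≢_)

open Equivalence using (to; from)

p q r s : Formula
p = var 0
q = var 1
r = var 2
s = var 3

module _ (F : Frame) where
  open Frame F

  ↑-upward : IsS4 F → ∀ {X u v} → R u v → ↑ F X u → ↑ F X v
  ↑-upward S4 uv (x , Xx , xu) = x , Xx , IsS4.trans S4 xu uv

  □-map : ∀ {X Y : Subset F} → (∀ {v} → X v → Y v) → ∀ {z} → □ F X z → □ F Y z
  □-map X⊆Y □X v zv = X⊆Y (□X v zv)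

  ↑[_] : W → Subset F
  ↑[ a ] = ↑ F (｛_｝ F a)

  ↑[]-self : IsS4 F → ∀ a → ↑[ a ] a
  ↑[]-self S4 a = a , refl , IsS4.refl S4 a

  UnitesOver : W → W → W → Set
  UnitesOver z a b = R z a × □ F (λ v → ↑[ a ] v ⊎ ◇ F (↑[ b ]) v) z

  stronglyUnites₂⇔ : ∀ {z} {x : Fin 2 → W} →
    StronglyUnites F 2 z x ⇔ (∀ i → UnitesOver z (x i) (x (opposite i)))
  stronglyUnites₂⇔ {z} {x} = mk⇔
    (λ unites i → Product.map₂ (□-map (Sum.map₂ (onlyOpposite i))) (unites i))
    (λ unites i → Product.map₂ (□-map (Sum.map₂ (opposite-≢ i))) (unites i))
    where
    onlyOpposite : ∀ i {v} → Σ (Fin 2) (λ i' → i' ≢ i × ◇ F (↑[ x i' ]) v) →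
                   ◇ F (↑[ x (opposite i) ]) v
    onlyOpposite zero       (suc zero , _ , d) = d
    onlyOpposite zero       (zero , ≢i , _)    = ⊥-elim (≢i refl)
    onlyOpposite (suc zero) (zero , _ , d)     = d
    onlyOpposite (suc zero) (suc zero , ≢i , _) = ⊥-elim (≢i refl)
    opposite-≢ : ∀ i {v} → ◇ F (↑[ x (opposite i) ]) v →
                 Σ (Fin 2) (λ i' → i' ≢ i × ◇ F (↑[ x i' ]) v)
    opposite-≢ zero       d = suc zero , (λ ()) , d
    opposite-≢ (suc zero) d = zero , (λ ()) , d

  separatingValuation : W → W → Valuation F
  separatingValuation x₀ x₁ 0 v = ↑[ x₀ ] v
  separatingValuation x₀ x₁ 1 v = ↑[ x₁ ] v
  separatingValuation x₀ x₁ 2 v = ¬ R v x₀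
  separatingValuation x₀ x₁ 3 v = ¬ R v x₁
  separatingValuation _  _  _ _ = Empty

  separatingValuation-monotonic : IsS4 F → ∀ x₀ x₁ → Monotonic F (separatingValuation x₀ x₁)
  separatingValuation-monotonic S4 x₀ x₁ 0 uv = ↑-upward S4 uv
  separatingValuation-monotonic S4 x₀ x₁ 1 uv = ↑-upward S4 uv
  separatingValuation-monotonic S4 x₀ x₁ 2 uv ¬ux₀ vx₀ = ¬ux₀ (IsS4.trans S4 uv vx₀)
  separatingValuation-monotonic S4 x₀ x₁ 3 uv ¬ux₁ vx₁ = ¬ux₁ (IsS4.trans S4 uv vx₁)
  separatingValuation-monotonic S4 x₀ x₁ (suc (suc (suc (suc _)))) uv ()

module Classical (em : ExcludedMiddle 0ℓ) where

  ¬¬-elim : {P : Set} → ¬ ¬ P → P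
  ¬¬-elim = em⇒dne em

  ¬∀⇒∃¬ : {A : Set} {P Q : A → Set} → ¬ (∀ a → P a → Q a) → ∃ λ a → P a × ¬ Q a
  ¬∀⇒∃¬ ¬∀ = ¬¬-elim λ ¬∃ → ¬∀ λ a Pa → ¬¬-elim λ ¬Qa → ¬∃ (a , Pa , ¬Qa)

  module _ (F : Frame) where
    open Frame F

    ⊮⇒-witness : ∀ V {w} φ ψ → ¬ forces F V w (φ ⇒ ψ) →
                 ∃ λ v → (R w v × forces F V v φ) × ¬ forces F V v ψ
    ⊮⇒-witness V φ ψ ⊮φ⇒ψ = ¬∀⇒∃¬ λ ⊩ → ⊮φ⇒ψ λ v wv ⊩φ → ⊩ v (wv , ⊩φ)

    ⊩¬⇒⇔□ : ∀ V {z} m n → forces F V z (¬f var n ⇒ var m) ⇔ □ F (λ v → V m v ⊎ ◇ F (V n) v) z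
    ⊩¬⇒⇔□ V m n = mk⇔
      (λ ⊩¬n⇒m v zv → Sum.map₁ (⊩¬n⇒m v zv) (Sum.swap (◇-or-⊩¬ v)))
      (λ □m◇n v zv ⊩¬n → Sum.fromInj₁ (λ (t , Vnt , vt) → ⊥-elim (⊩¬n t vt Vnt)) (□m◇n v zv))
      where
      ◇-or-⊩¬ : ∀ v → ◇ F (V n) v ⊎ forces F V v (¬f var n)
      ◇-or-⊩¬ v with em {◇ F (V n) v}
      ... | yes ◇n = inj₁ ◇n
      ... | no ¬◇n = inj₂ λ t vt Vnt → ¬◇n (t , Vnt , vt)

    unitesOver⇒⊩¬⇒ : ∀ {V} → Monotonic F V → ∀ {z a b} m n → UnitesOver F z a b →
                      V m a → V n b → forces F V z (¬f var n ⇒ var m)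
    unitesOver⇒⊩¬⇒ {V} mon m n (_ , □↑a◇↑b) Vma Vnb =
      from (⊩¬⇒⇔□ V m n) (□-map F (Sum.map (upward Vma) (◇-upward Vnb)) □↑a◇↑b)
      where
      upward : ∀ {k x v} → V k x → ↑[_] F x v → V k v
      upward {k} Vkx (_ , refl , xv) = mon k xv Vkx
      ◇-upward : ∀ {k x v} → V k x → ◇ F (↑[_] F x) v → ◇ F (V k) v
      ◇-upward Vkx = Product.map₂ (Product.map₁ (upward Vkx))

  su₂⇒validates-su : (F : Frame) → SU F 2 → Validates F su
  su₂⇒validates-su F su₂ V mon _ v _ ⊩premise
    with em {forces F V v (p ⇒ r)} | em {forces F V v (q ⇒ s)}
  ... | yes ⊩p⇒r | _        = inj₁ ⊩p⇒r
  ... | no _     | yes ⊩q⇒s = inj₂ ⊩q⇒s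
  ... | no ⊮p⇒r  | no ⊮q⇒s  = ⊥-elim (refuted (⊮⇒-witness F V p r ⊮p⇒r) (⊮⇒-witness F V q s ⊮q⇒s))
    where
    open Frame F
    refuted : ∃ (λ x → (R v x × V 0 x) × ¬ V 2 x) → ∃ (λ x → (R v x × V 1 x) × ¬ V 3 x) → Empty
    refuted (x₀ , (vx₀ , px₀) , ¬rx₀) (x₁ , (vx₁ , qx₁) , ¬sx₁) =
      let z , vz , unites = su₂ v (x₀ ∷ x₁ ∷ []) (λ { zero → vx₀ ; (suc zero) → vx₁ })
          u₀ = to (stronglyUnites₂⇔ F) unites zero
          u₁ = to (stronglyUnites₂⇔ F) unites (suc zero)
          ⊩r∨s = ⊩premise z vz ( unitesOver⇒⊩¬⇒ F mon 1 0 u₁ qx₁ px₀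
                               , unitesOver⇒⊩¬⇒ F mon 0 1 u₀ px₀ qx₁)
      in Sum.[ ¬rx₀ ∘ mon 2 (proj₁ u₀) , ¬sx₁ ∘ mon 3 (proj₁ u₁) ] ⊩r∨s

  validates-su⇒su₂ : (F : Frame) → IsS4 F → Validates F su → SU F 2
  validates-su⇒su₂ F S4 valid w x wx = uniter (⊮⇒-witness F V premise (r ∨ s) ⊮premise)
    where
    open Frame F
    x₀ = x zero
    x₁ = x (suc zero)
    V = separatingValuation F x₀ x₁
    premise = (¬f p ⇒ q) ∧ (¬f q ⇒ p)

    ⊮premise : ¬ forces F V w (premise ⇒ r ∨ s)
    ⊮premise ⊩ with valid V (separatingValuation-monotonic F S4 x₀ x₁) w w (IsS4.refl S4 w) ⊩
    ... | inj₁ ⊩p⇒r = ⊩p⇒r x₀ (wx zero) (↑[]-self F S4 x₀) (IsS4.refl S4 x₀)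
    ... | inj₂ ⊩q⇒s = ⊩q⇒s x₁ (wx (suc zero)) (↑[]-self F S4 x₁) (IsS4.refl S4 x₁)

    uniter : ∃ (λ z → (R w z × forces F V z premise) × ¬ forces F V z (r ∨ s)) →
             ∃ λ z → R w z × StronglyUnites F 2 z x
    uniter (z , (wz , ⊩¬p⇒q , ⊩¬q⇒p) , ⊮r∨s) = z , wz , from (stronglyUnites₂⇔ F) λ where
      zero       → ¬¬-elim (⊮r∨s ∘ inj₁) , to (⊩¬⇒⇔□ F V 0 1) ⊩¬q⇒p
      (suc zero) → ¬¬-elim (⊮r∨s ∘ inj₂) , to (⊩¬⇒⇔□ F V 1 0) ⊩¬p⇒q

open Classical

theorem1 : ExcludedMiddle 0ℓ → (F : Frame) → IsS4 F → (Validates F su ⇔ SU F 2)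
theorem1 em F S4 = mk⇔ (validates-su⇒su₂ em F S4) (su₂⇒validates-su em F)
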